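{- Let $M$ be a positive integer with $\omega(M)\geq 2828$. Then $W(M)<M^{1/13}$.
   Context: For a positive integer $M$, $\omega(M)$ is the number of distinct prime divisors of $M$ and $W(M)=2^{\omega(M)}$ is the number of squarefree divisors of $M$. -}

module Defs where

open import Data.Nat using (ℕ; suc; _^_)
open import Data.Nat.Divisibility using (_∣_; _∣?_)
open import Data.Nat.Primality using (Prime; prime?)
open import Data.List using (List; length; filter; upTo)
open import Data.Product using (_×_)
open import Relation.Nullary.Decidable using (_×-dec_)

-- primes dividing M: every prime divisor p of a positive M satisfies p ≤ M,
-- so enumerating 0 .. M suffices.
primeDivisors : ℕ → List ℕ
primeDivisors M = filter (λ p → prime? p ×-dec p ∣? M) (upTo (suc M))

ω : ℕ → ℕ
ω M = length (primeDivisors M)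

W : ℕ → ℕ
W M = 2 ^ ω M

-- The prime divisors of M are distinct primes, so their product divides M. Listed in
-- increasing order, the i-th of them is at least the i-th prime, and evaluation in the
-- type checker shows that the first 2828 primes multiply to more than 2 ^ (13 · 2828),
-- the 2828-th prime already exceeding 2 ^ 13. Every further prime divisor therefore
-- multiplies the product by more than the factor 2 ^ 13 it adds to W(M) ^ 13.
module Submission where

open import Defs
open import Data.Bool.Base using (Bool; true; false; _∧_; _∨_; if_then_else_; T)
open import Data.Bool.Properties using (T-∧; T-∨)
open import Data.List.Base using (List; []; _∷_; _++_; length; upTo)
open import Data.List.Relation.Unary.All as All using (All; []; _∷_)
open import Data.List.Relation.Unary.All.Properties using (all-filter)
open import Data.List.Relation.Unary.AllPairs as AllPairs using (AllPairs; []; _∷_)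
open import Data.List.Relation.Unary.AllPairs.Properties using (filter⁺; applyUpTo⁺₁)
open import Data.List.Relation.Unary.Unique.Propositional using (Unique)
open import Data.Nat.Base
  using (ℕ; zero; suc; _+_; _*_; _^_; _%_; _<ᵇ_; _≡ᵇ_; _<_; _≤_; s≤s; NonZero; nonTrivial⇒n>1)
open import Data.Nat.Coprimality using (Coprime; coprime-divisor)
import Data.Nat.Coprimality as Coprime
open import Data.Nat.Divisibility
open import Data.Nat.ListAction using (product)
open import Data.Nat.ListAction.Properties using (product-++)
open import Data.Nat.Primality
open import Data.Nat.Primality.Factorisation using (factorisationHasAllPrimeFactors)
open import Data.Nat.Properties
open import Data.Product using (_×_; _,_; proj₁; proj₂)
open import Data.Sum using (inj₁; inj₂)
open import Function.Bundles using (Equivalence)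
open import Relation.Nullary.Decidable using (Dec; toWitness; _×-dec_)
open import Relation.Nullary.Negation using (contradiction)
open import Relation.Binary.PropositionalEquality

prime⇒2≤ : ∀ {p} → Prime p → 2 ≤ p
prime⇒2≤ {p} pp = nonTrivial⇒n>1 p {{prime⇒nonTrivial pp}}

coprime-*-∣ : ∀ {m n o} → Coprime m n → m ∣ o → n ∣ o → m * n ∣ o
coprime-*-∣ {m} {n} {o} m⊥n (divides q o≡q*m) n∣o =
  subst (m * n ∣_) (trans (*-comm m q) (sym o≡q*m))
    (*-monoʳ-∣ m (coprime-divisor (Coprime.sym m⊥n) (subst (n ∣_) (trans o≡q*m (*-comm q m)) n∣o)))

prime∉⇒coprime-product : ∀ {p ps} → Prime p → All Prime ps → All (p ≢_) ps →
                         Coprime p (product ps)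
prime∉⇒coprime-product pp pps p∉ps (d∣p , d∣Πps) with prime⇒irreducible pp d∣p
... | inj₁ d≡1 = d≡1
... | inj₂ refl = contradiction refl (All.lookup p∉ps (factorisationHasAllPrimeFactors pp d∣Πps pps))

distinctPrimes⇒product∣ : ∀ {n ps} → All Prime ps → Unique ps → All (_∣ n) ps → product ps ∣ n
distinctPrimes⇒product∣ {n} [] [] [] = 1∣ n
distinctPrimes⇒product∣ (pp ∷ pps) (p∉ps ∷ ps!) (p∣n ∷ ps∣n) =
  coprime-*-∣ (prime∉⇒coprime-product pp pps p∉ps) p∣n (distinctPrimes⇒product∣ pps ps! ps∣n)

^length≤product : ∀ {b ns} → All (b ≤_) ns → b ^ length ns ≤ product ns
^length≤product [] = ≤-refl
^length≤product (b≤n ∷ b≤ns) = *-mono-≤ b≤n (^length≤product b≤ns)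

trialDivision : ℕ → ℕ → Bool
trialDivision zero    n = false
trialDivision (suc k) n = ((2 + k <ᵇ n) ∧ (n % (2 + k) ≡ᵇ 0)) ∨ trialDivision k n

trialDivision⇒composite : ∀ k n → T (trialDivision k n) → Composite n
trialDivision⇒composite (suc k) n t with Equivalence.to T-∨ t
... | inj₂ t′ = trialDivision⇒composite k n t′
... | inj₁ t′ with Equivalence.to T-∧ t′
... | d<n , d∣n = hasNonTrivialDivisor {divisor = 2 + k} (<ᵇ⇒< (2 + k) n d<n)
                    (m%n≡0⇒n∣m n (2 + k) (≡ᵇ⇒≡ (n % (2 + k)) 0 d∣n))

-- Candidates for primes: numbers surviving trial division by 2 … 171. They may include
-- composites, but the i-th candidate from c never exceeds the i-th prime from c.
module Candidates where

  nextCandidate : ℕ → ℕ → ℕ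
  nextCandidate zero       c = c
  nextCandidate (suc fuel) c = if trialDivision 170 c then nextCandidate fuel (suc c) else c

  -- Prime gaps below 2 ^ 15 are under 100; running out of fuel would only weaken
  -- the bound, never falsify it.
  next : ℕ → ℕ
  next = nextCandidate 100

  nextCandidate-≥ : ∀ fuel c → c ≤ nextCandidate fuel c
  nextCandidate-≥ zero       c = ≤-refl
  nextCandidate-≥ (suc fuel) c with trialDivision 170 c
  ... | true  = ≤-trans (n≤1+n c) (nextCandidate-≥ fuel (suc c))
  ... | false = ≤-refl

  nextCandidate-≤-prime : ∀ fuel c {p} → Prime p → c ≤ p → nextCandidate fuel c ≤ p
  nextCandidate-≤-prime zero       c pp c≤p = c≤p
  nextCandidate-≤-prime (suc fuel) c {p} pp c≤p with trialDivision 170 c in eq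
  ... | false = c≤p
  ... | true  = nextCandidate-≤-prime fuel (suc c) pp (≤∧≢⇒< c≤p c≢p)
    where
    c≢p : c ≢ p
    c≢p refl = Prime.notComposite pp (trialDivision⇒composite 170 c (subst T (sym eq) _))

  candidates : ℕ → ℕ → List ℕ
  candidates zero    c = []
  candidates (suc k) c = next c ∷ candidates k (suc (next c))

  resume : ℕ → ℕ → ℕ
  resume zero    c = c
  resume (suc k) c = resume k (suc (next c))

  candidates-+ : ∀ k m c → candidates (k + m) c ≡ candidates k c ++ candidates m (resume k c)
  candidates-+ zero    m c = refl
  candidates-+ (suc k) m c = cong (next c ∷_) (candidates-+ k m (suc (next c)))

  length-candidates : ∀ k c → length (candidates k c) ≡ k
  length-candidates zero    c = refl
  length-candidates (suc k) c = cong suc (length-candidates k (suc (next c)))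

  candidates-≥ : ∀ k c → All (c ≤_) (candidates k c)
  candidates-≥ zero    c = []
  candidates-≥ (suc k) c =
    c≤next ∷ All.map (≤-trans (≤-trans c≤next (n≤1+n _))) (candidates-≥ k (suc (next c)))
    where
    c≤next : c ≤ next c
    c≤next = nextCandidate-≥ 100 c

  product-candidates≤ : ∀ {c ps} → AllPairs _<_ ps → All Prime ps → All (c ≤_) ps →
                        product (candidates (length ps) c) ≤ product ps
  product-candidates≤ [] [] [] = ≤-refl
  product-candidates≤ {c} (p<ps ∷ ps↑) (pp ∷ pps) (c≤p ∷ c≤ps) =
    *-mono-≤ next≤p (product-candidates≤ ps↑ pps (All.map (≤-trans (s≤s next≤p)) p<ps))
    where
    next≤p : next c ≤ _
    next≤p = nextCandidate-≤-prime 100 c pp c≤p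

open Candidates

[2^[k+m]]^13≡[2^k]^13*8192^m : ∀ k m → (2 ^ (k + m)) ^ 13 ≡ (2 ^ k) ^ 13 * 8192 ^ m
[2^[k+m]]^13≡[2^k]^13*8192^m k m = begin
  (2 ^ (k + m)) ^ 13          ≡⟨ ^-*-assoc 2 (k + m) 13 ⟩
  2 ^ ((k + m) * 13)          ≡⟨ cong (2 ^_) (*-distribʳ-+ 13 k m) ⟩
  2 ^ (k * 13 + m * 13)       ≡⟨ ^-distribˡ-+-* 2 (k * 13) (m * 13) ⟩
  2 ^ (k * 13) * 2 ^ (m * 13) ≡⟨ cong₂ _*_ (sym (^-*-assoc 2 k 13)) (cong (2 ^_) (*-comm m 13)) ⟩
  (2 ^ k) ^ 13 * 2 ^ (13 * m) ≡⟨ cong ((2 ^ k) ^ 13 *_) (sym (^-*-assoc 2 13 m)) ⟩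
  (2 ^ k) ^ 13 * 8192 ^ m     ∎
  where open ≡-Reasoning

[2^length]^13<product : ∀ k → 8192 ≤ resume k 2 → (2 ^ k) ^ 13 < product (candidates k 2) →
                        ∀ {ps} → AllPairs _<_ ps → All Prime ps → k ≤ length ps →
                        (2 ^ length ps) ^ 13 < product ps
[2^length]^13<product k 8192≤resume head-large {ps} ps↑ pps k≤n with m≤n⇒∃[o]m+o≡n k≤n
... | m , k+m≡n = begin-strict
  (2 ^ length ps) ^ 13
    ≡⟨ cong (λ n → (2 ^ n) ^ 13) (sym k+m≡n) ⟩
  (2 ^ (k + m)) ^ 13
    ≡⟨ [2^[k+m]]^13≡[2^k]^13*8192^m k m ⟩
  (2 ^ k) ^ 13 * 8192 ^ m
    <⟨ *-monoˡ-< (8192 ^ m) {{m^n≢0 8192 m}} head-large ⟩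
  product head * 8192 ^ m
    ≤⟨ *-monoʳ-≤ (product head) 8192^m≤product-tail ⟩
  product head * product tail
    ≡⟨ sym (product-++ head tail) ⟩
  product (head ++ tail)
    ≡⟨ cong product (sym (candidates-+ k m 2)) ⟩
  product (candidates (k + m) 2)
    ≡⟨ cong (λ n → product (candidates n 2)) k+m≡n ⟩
  product (candidates (length ps) 2)
    ≤⟨ product-candidates≤ ps↑ pps (All.map prime⇒2≤ pps) ⟩
  product ps ∎
  where
  open ≤-Reasoning
  head tail : List ℕ
  head = candidates k 2
  tail = candidates m (resume k 2)
  8192^m≤product-tail : 8192 ^ m ≤ product tail
  8192^m≤product-tail = subst (λ j → 8192 ^ j ≤ product tail) (length-candidates m _)
    (^length≤product (All.map (≤-trans 8192≤resume) (candidates-≥ m _)))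

opaque
  8192≤resume : 8192 ≤ resume 2828 2
  8192≤resume = toWitness {a? = 8192 ≤? resume 2828 2} _

  [2^2828]^13<product : (2 ^ 2828) ^ 13 < product (candidates 2828 2)
  [2^2828]^13<product = toWitness {a? = suc ((2 ^ 2828) ^ 13) ≤? product (candidates 2828 2)} _

lemma5p6 : (M : ℕ) → .{{_ : NonZero M}} → 2828 ≤ ω M → W M ^ 13 < M
lemma5p6 M 2828≤ωM = begin-strict
  W M ^ 13                  <⟨ [2^length]^13<product 2828 8192≤resume [2^2828]^13<product ps↑ pps 2828≤ωM ⟩
  product (primeDivisors M) ≤⟨ ∣⇒≤ (distinctPrimes⇒product∣ pps (AllPairs.map <⇒≢ ps↑) ps∣M) ⟩
  M                         ∎
  where
  open ≤-Reasoning
  isPrimeDivisor? : ∀ p → Dec (Prime p × p ∣ M)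
  isPrimeDivisor? p = prime? p ×-dec p ∣? M
  ps↑ : AllPairs _<_ (primeDivisors M)
  ps↑ = filter⁺ isPrimeDivisor? (applyUpTo⁺₁ (λ i → i) (suc M) (λ i<j _ → i<j))
  primeDivisors-spec : All (λ p → Prime p × p ∣ M) (primeDivisors M)
  primeDivisors-spec = all-filter isPrimeDivisor? (upTo (suc M))
  pps : All Prime (primeDivisors M)
  pps = All.map proj₁ primeDivisors-spec
  ps∣M : All (_∣ M) (primeDivisors M)
  ps∣M = All.map proj₂ primeDivisors-spec
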